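{- For every integer $k>0$, there is a Las Vegas probabilistic finite automaton with $2\cdot 2^k$ states that recognizes $\mathtt{MODXOR}_k$ with success probability $1/2$.
   Context: For $k>0$, $\mathtt{MODXOR}_k\subseteq\{0,1\}^*$ is the set of strings of the form $w_0\,x_1\,u_1\,x_2\,u_2\cdots x_m\,u_m$ where $m>0$, $w_0\in\{0,1\}^*$ has length less than $2k$, each $x_i\in\{0,1\}$, each $u_i\in\{0,1\}^{2k-1}$, and $x_1\oplus\cdots\oplus x_m=1$. A probabilistic finite automaton (PFA) has a finite state set, an initial probability distribution, and a column-stochastic transition matrix for each input symbol (optionally also for a right end-marker read after the input). A Las Vegas PFA has its states partitioned into accepting, rejecting and neutral ("don't know") states; it recognizes $L$ with success probability $p$ if for every input $w$ it ends in a state giving the wrong answer with probability $0$ and in a state giving the correct answer ($w\in L$ or $w\notin L$) with probability at least $p$. -}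

module Defs where

open import Data.Nat using (ℕ; zero; suc; _<_; _∸_) renaming (_*_ to _*ℕ_)
open import Data.Fin using (Fin; zero; suc)
open import Data.Bool using (Bool; true; false; _xor_)
open import Data.List using (List; []; _∷_; _++_; length; foldl; foldr; concatMap; map)
open import Data.Product using (Σ; _×_; _,_; ∃; proj₁; proj₂)
open import Data.Rational using (ℚ; 0ℚ; 1ℚ; _+_; _*_; _≤_)
open import Relation.Binary.PropositionalEquality using (_≡_)
open import Relation.Nullary using (¬_)
open import Data.List.Membership.Propositional using (_∈_)

Σᶠ : (n : ℕ) → (Fin n → ℚ) → ℚ
Σᶠ zero    f = 0ℚ
Σᶠ (suc n) f = f zero + Σᶠ n (λ i → f (suc i))

-- Probability vectors and column-stochastic matrices over states Fin n
-- A matrix M : Fin n → Fin n → ℚ, where M j i is the probability of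
-- moving from state i to state j (column i is a distribution).

IsDistribution : (n : ℕ) → (Fin n → ℚ) → Set
IsDistribution n d = (∀ i → 0ℚ ≤ d i) × (Σᶠ n d ≡ 1ℚ)

IsColumnStochastic : (n : ℕ) → (Fin n → Fin n → ℚ) → Set
IsColumnStochastic n M = ∀ i → IsDistribution n (λ j → M j i)

data Verdict : Set where
  accept reject neutral : Verdict

indicator : Verdict → Verdict → ℚ
indicator accept  accept  = 1ℚ
indicator reject  reject  = 1ℚ
indicator neutral neutral = 1ℚ
indicator accept  reject  = 0ℚ
indicator accept  neutral = 0ℚ
indicator reject  accept  = 0ℚ
indicator reject  neutral = 0ℚ
indicator neutral accept  = 0ℚ
indicator neutral reject  = 0ℚ

-- A Las Vegas PFA over the alphabet {0,1} (= Bool) with n states,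
-- with an (optional, possibly identity) right end-marker matrix.
record LasVegasPFA (n : ℕ) : Set where
  field
    init      : Fin n → ℚ
    trans     : Bool → Fin n → Fin n → ℚ
    endMarker : Fin n → Fin n → ℚ
    verdict   : Fin n → Verdict
    initDist  : IsDistribution n init
    transStoch : ∀ a → IsColumnStochastic n (trans a)
    endStoch  : IsColumnStochastic n endMarker

apply : (n : ℕ) → (Fin n → Fin n → ℚ) → (Fin n → ℚ) → (Fin n → ℚ)
apply n M d j = Σᶠ n (λ i → M j i * d i)

module _ {n : ℕ} (A : LasVegasPFA n) where
  open LasVegasPFA A

  finalDist : List Bool → Fin n → ℚ
  finalDist w = apply n endMarker (foldl (λ d a → apply n (trans a) d) init w)

  probVerdict : Verdict → List Bool → ℚ
  probVerdict v w = Σᶠ n (λ i → indicator v (verdict i) * finalDist w i)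

RecognizesLV : {n : ℕ} → LasVegasPFA n → (List Bool → Set) → ℚ → Set
RecognizesLV A L p =
  ∀ w → (L w → (probVerdict A reject w ≡ 0ℚ) × (p ≤ probVerdict A accept w))
      × (¬ L w → (probVerdict A accept w ≡ 0ℚ) × (p ≤ probVerdict A reject w))

xorAll : List Bool → Bool
xorAll = foldr _xor_ false

MODXOR : ℕ → List Bool → Set
MODXOR k w =
  Σ (List Bool) λ w0 → Σ (List (Bool × List Bool)) λ blocks →
    (length w0 < 2 *ℕ k)
    × (0 < length blocks)
    × (∀ b → b ∈ blocks → length (proj₂ b) ≡ 2 *ℕ k ∸ 1)
    × (w ≡ w0 ++ concatMap (λ b → proj₁ b ∷ proj₂ b) blocks)
    × (xorAll (map proj₁ blocks) ≡ true)

-- The automaton keeps a phase bit and a queue of k bits, initially all 0. In the active phase it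
-- reads a symbol a, pops the front bit x of the queue and pushes x ⊕ a to its back; in the idle
-- phase it skips the symbol. Phases alternate, so a run reads every other symbol, and a block of
-- 2k symbols turns the queue around exactly once: an active run stays active and its front bit is
-- xored with the first symbol of the block. A prefix w₀ with |w₀| < 2k turns the queue less than
-- once, so the run that is active at the first block still has front bit 0 there. Starting the
-- two phases with probability ½ each, on w₀ x₁ u₁ ⋯ xₘ uₘ one run ends active with front bit
-- x₁ ⊕ ⋯ ⊕ xₘ and answers with it, while the other ends idle and answers "don't know". Every
-- word splits into such a prefix and blocks, which also settles the words outside MODXOR.

module Submission where

open import Defs
open import Data.Nat using (ℕ; _<_; _*_; _^_)
open import Data.Product using (Σ)
open import Data.Rational using (½)

open import Algebra using (CommutativeMonoid)
import Algebra.Properties.CommutativeSemigroup as CommSemigroupProperties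
open import Data.Bool using (Bool; true; false; not; _xor_; if_then_else_)
open import Data.Bool.Properties using (xor-assoc; xor-identityʳ)
open import Data.Empty using (⊥-elim)
open import Data.Fin using (Fin; zero; suc; combine; quotient; remainder)
open import Data.Fin.Properties using (_≟_; remQuot-combine; 2↔Bool)
open import Data.List using (List; []; _∷_; _++_; length; foldl; concatMap; map; replicate; zipWith)
open import Data.List.Membership.Propositional using (_∈_)
open import Data.List.Properties
  using (++-identityʳ; ++-assoc; length-++; length-replicate; foldl-++; ∷-injective)
open import Data.List.Relation.Unary.Any using (here; there)
open import Data.Nat using (zero; suc; _+_; _∸_; _≤_; _<?_; z≤n; s≤s; s≤s⁻¹)
open import Data.Nat.Properties
  using (suc-injective; +-suc; +-comm; *-suc; *-cancelˡ-≡; *-cancelˡ-<; even≢odd;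
         m+[n∸m]≡n; ≤-antisym; ≮⇒≥; ≤-<-trans; <-trans; n<1+n)
open import Data.Product using (_×_; _,_; proj₁; proj₂; ∃; ∃₂)
open import Data.Rational using (ℚ; 0ℚ; 1ℚ; NonNegative)
  renaming (_+_ to _+ℚ_; _*_ to _*ℚ_; _≤_ to _≤ℚ_)
import Data.Rational.Properties as ℚ
open import Data.Sum using (_⊎_; inj₁; inj₂)
open import Function using (Inverse; id; _∘_)
open import Relation.Binary.PropositionalEquality
open import Relation.Nullary using (¬_; does; yes; no)

open CommSemigroupProperties (CommutativeMonoid.commutativeSemigroup ℚ.+-0-commutativeMonoid)
  using (interchange)
open CommSemigroupProperties (CommutativeMonoid.commutativeSemigroup ℚ.*-1-commutativeMonoid)
  using (x∙yz≈y∙xz)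

Σᶠ-cong : ∀ n {f g : Fin n → ℚ} → (∀ i → f i ≡ g i) → Σᶠ n f ≡ Σᶠ n g
Σᶠ-cong zero    f≗g = refl
Σᶠ-cong (suc n) f≗g = cong₂ _+ℚ_ (f≗g zero) (Σᶠ-cong n (f≗g ∘ suc))

Σᶠ-zero : ∀ n {f : Fin n → ℚ} → (∀ i → f i ≡ 0ℚ) → Σᶠ n f ≡ 0ℚ
Σᶠ-zero zero    f≗0 = refl
Σᶠ-zero (suc n) f≗0 = cong₂ _+ℚ_ (f≗0 zero) (Σᶠ-zero n (f≗0 ∘ suc))

Σᶠ-+ : ∀ n (f g : Fin n → ℚ) → Σᶠ n (λ i → f i +ℚ g i) ≡ Σᶠ n f +ℚ Σᶠ n g
Σᶠ-+ zero    f g = refl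
Σᶠ-+ (suc n) f g =
  trans (cong (f zero +ℚ g zero +ℚ_) (Σᶠ-+ n (f ∘ suc) (g ∘ suc)))
        (interchange (f zero) (g zero) (Σᶠ n (f ∘ suc)) (Σᶠ n (g ∘ suc)))

Σᶠ-*ˡ : ∀ n c (f : Fin n → ℚ) → Σᶠ n (λ i → c *ℚ f i) ≡ c *ℚ Σᶠ n f
Σᶠ-*ˡ zero    c f = sym (ℚ.*-zeroʳ c)
Σᶠ-*ˡ (suc n) c f =
  trans (cong (c *ℚ f zero +ℚ_) (Σᶠ-*ˡ n c (f ∘ suc))) (sym (ℚ.*-distribˡ-+ c _ _))

point : ∀ {n} → Fin n → Fin n → ℚ
point s i = if does (i ≟ s) then 1ℚ else 0ℚ

point-nonNeg : ∀ {n} (s i : Fin n) → NonNegative (point s i)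
point-nonNeg s i with does (i ≟ s)
... | true  = _
... | false = _

Σᶠ-point : ∀ n (f : Fin n → ℚ) s → Σᶠ n (λ i → f i *ℚ point s i) ≡ f s
Σᶠ-point (suc n) f zero = begin
    f zero *ℚ 1ℚ +ℚ Σᶠ n (λ i → f (suc i) *ℚ 0ℚ)
  ≡⟨ cong₂ _+ℚ_ (ℚ.*-identityʳ (f zero)) (Σᶠ-zero n (λ i → ℚ.*-zeroʳ (f (suc i)))) ⟩
    f zero +ℚ 0ℚ
  ≡⟨ ℚ.+-identityʳ (f zero) ⟩
    f zero ∎
  where open ≡-Reasoning
Σᶠ-point (suc n) f (suc s) = begin
    f zero *ℚ 0ℚ +ℚ Σᶠ n (λ i → f (suc i) *ℚ point s i)
  ≡⟨ cong₂ _+ℚ_ (ℚ.*-zeroʳ (f zero)) (Σᶠ-point n (f ∘ suc) s) ⟩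
    0ℚ +ℚ f (suc s)
  ≡⟨ ℚ.+-identityˡ (f (suc s)) ⟩
    f (suc s) ∎
  where open ≡-Reasoning

Σᶠ-point≡1 : ∀ n (s : Fin n) → Σᶠ n (point s) ≡ 1ℚ
Σᶠ-point≡1 n s =
  trans (Σᶠ-cong n (λ i → sym (ℚ.*-identityˡ (point s i)))) (Σᶠ-point n (λ _ → 1ℚ) s)

mixture : ∀ {n} → ℚ → ℚ → Fin n → Fin n → Fin n → ℚ
mixture p q s₀ s₁ i = p *ℚ point s₀ i +ℚ q *ℚ point s₁ i

Σᶠ-mixture : ∀ n (f : Fin n → ℚ) p q s₀ s₁ →
  Σᶠ n (λ i → f i *ℚ mixture p q s₀ s₁ i) ≡ p *ℚ f s₀ +ℚ q *ℚ f s₁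
Σᶠ-mixture n f p q s₀ s₁ = begin
    Σᶠ n (λ i → f i *ℚ mixture p q s₀ s₁ i)
  ≡⟨ Σᶠ-cong n (λ i → trans (ℚ.*-distribˡ-+ (f i) _ _)
                            (cong₂ _+ℚ_ (x∙yz≈y∙xz (f i) p _) (x∙yz≈y∙xz (f i) q _))) ⟩
    Σᶠ n (λ i → p *ℚ (f i *ℚ point s₀ i) +ℚ q *ℚ (f i *ℚ point s₁ i))
  ≡⟨ Σᶠ-+ n _ _ ⟩
    Σᶠ n (λ i → p *ℚ (f i *ℚ point s₀ i)) +ℚ Σᶠ n (λ i → q *ℚ (f i *ℚ point s₁ i))
  ≡⟨ cong₂ _+ℚ_ (Σᶠ-*ˡ n p _) (Σᶠ-*ˡ n q _) ⟩
    p *ℚ Σᶠ n (λ i → f i *ℚ point s₀ i) +ℚ q *ℚ Σᶠ n (λ i → f i *ℚ point s₁ i)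
  ≡⟨ cong₂ (λ x y → p *ℚ x +ℚ q *ℚ y) (Σᶠ-point n f s₀) (Σᶠ-point n f s₁) ⟩
    p *ℚ f s₀ +ℚ q *ℚ f s₁ ∎
  where open ≡-Reasoning

mixture-isDistribution : ∀ n p q .{{_ : NonNegative p}} .{{_ : NonNegative q}} →
  p +ℚ q ≡ 1ℚ → (s₀ s₁ : Fin n) → IsDistribution n (mixture p q s₀ s₁)
mixture-isDistribution n p q p+q≡1 s₀ s₁ = nonNeg , total
  where
  nonNeg : ∀ i → 0ℚ ≤ℚ mixture p q s₀ s₁ i
  nonNeg i = ℚ.nonNegative⁻¹ _
    {{ℚ.nonNeg+nonNeg⇒nonNeg
        (p *ℚ point s₀ i) {{ℚ.nonNeg*nonNeg⇒nonNeg p (point s₀ i) {{point-nonNeg s₀ i}}}}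
        (q *ℚ point s₁ i) {{ℚ.nonNeg*nonNeg⇒nonNeg q (point s₁ i) {{point-nonNeg s₁ i}}}}}}
  total : Σᶠ n (mixture p q s₀ s₁) ≡ 1ℚ
  total = begin
      Σᶠ n (mixture p q s₀ s₁)
    ≡⟨ Σᶠ-cong n (λ i → sym (ℚ.*-identityˡ _)) ⟩
      Σᶠ n (λ i → 1ℚ *ℚ mixture p q s₀ s₁ i)
    ≡⟨ Σᶠ-mixture n (λ _ → 1ℚ) p q s₀ s₁ ⟩
      p *ℚ 1ℚ +ℚ q *ℚ 1ℚ
    ≡⟨ cong₂ _+ℚ_ (ℚ.*-identityʳ p) (ℚ.*-identityʳ q) ⟩
      p +ℚ q
    ≡⟨ p+q≡1 ⟩
      1ℚ ∎
    where open ≡-Reasoning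

-- Deterministic automata with a random start state

deterministic : ∀ {n} → (Fin n → Fin n) → Fin n → Fin n → ℚ
deterministic f j i = point (f i) j

deterministic-isColumnStochastic : ∀ n (f : Fin n → Fin n) → IsColumnStochastic n (deterministic f)
deterministic-isColumnStochastic n f i =
  (λ j → ℚ.nonNegative⁻¹ _ {{point-nonNeg (f i) j}}) , Σᶠ-point≡1 n (f i)

apply-cong : ∀ n M {d e : Fin n → ℚ} → (∀ i → d i ≡ e i) → ∀ j → apply n M d j ≡ apply n M e j
apply-cong n M d≗e j = Σᶠ-cong n (λ i → cong (M j i *ℚ_) (d≗e i))

apply-deterministic-mixture : ∀ n (f : Fin n → Fin n) p q s₀ s₁ j →
  apply n (deterministic f) (mixture p q s₀ s₁) j ≡ mixture p q (f s₀) (f s₁) j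
apply-deterministic-mixture n f p q s₀ s₁ j = Σᶠ-mixture n (λ i → point (f i) j) p q s₀ s₁

module _ {n : ℕ} (δ : Fin n → Bool → Fin n) where

  foldl-apply-deterministic : ∀ w p q s₀ s₁ {d : Fin n → ℚ} → (∀ i → d i ≡ mixture p q s₀ s₁ i) →
    ∀ j → foldl (λ d a → apply n (deterministic (λ i → δ i a)) d) d w j
          ≡ mixture p q (foldl δ s₀ w) (foldl δ s₁ w) j
  foldl-apply-deterministic []      p q s₀ s₁ d≗ = d≗
  foldl-apply-deterministic (a ∷ w) p q s₀ s₁ d≗ =
    foldl-apply-deterministic w p q (δ s₀ a) (δ s₁ a) λ j →
      trans (apply-cong n (deterministic (λ i → δ i a)) d≗ j)
            (apply-deterministic-mixture n (λ i → δ i a) p q s₀ s₁ j)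

  coinFlipStartPFA : (Fin n → Verdict) → Fin n → Fin n → LasVegasPFA n
  coinFlipStartPFA verdict s₀ s₁ = record
    { init       = mixture ½ ½ s₀ s₁
    ; trans      = λ a → deterministic (λ i → δ i a)
    ; endMarker  = deterministic id
    ; verdict    = verdict
    ; initDist   = mixture-isDistribution n ½ ½ refl s₀ s₁
    ; transStoch = λ a → deterministic-isColumnStochastic n (λ i → δ i a)
    ; endStoch   = deterministic-isColumnStochastic n id
    }

  probVerdict-coinFlipStartPFA : ∀ verdict s₀ s₁ v w →
    probVerdict (coinFlipStartPFA verdict s₀ s₁) v w
      ≡ ½ *ℚ indicator v (verdict (foldl δ s₀ w)) +ℚ ½ *ℚ indicator v (verdict (foldl δ s₁ w))
  probVerdict-coinFlipStartPFA verdict s₀ s₁ v w =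
    trans (Σᶠ-cong n (λ i → cong (indicator v (verdict i) *ℚ_) (finalDist≗ i)))
          (Σᶠ-mixture n (indicator v ∘ verdict) ½ ½ (foldl δ s₀ w) (foldl δ s₁ w))
    where
    finalDist≗ : ∀ j → finalDist (coinFlipStartPFA verdict s₀ s₁) w j
                       ≡ mixture ½ ½ (foldl δ s₀ w) (foldl δ s₁ w) j
    finalDist≗ j =
      trans (apply-cong n (deterministic id) (foldl-apply-deterministic w ½ ½ s₀ s₁ (λ _ → refl)) j)
            (apply-deterministic-mixture n id ½ ½ _ _ j)

answer : Bool → Verdict
answer true  = accept
answer false = reject

data OneDecides (b : Bool) : Verdict → Verdict → Set where
  first  : OneDecides b (answer b) neutral
  second : OneDecides b neutral (answer b)

coinFlip-oneDecides : ∀ {b v₀ v₁} → OneDecides b v₀ v₁ →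
  (½ *ℚ indicator (answer (not b)) v₀ +ℚ ½ *ℚ indicator (answer (not b)) v₁ ≡ 0ℚ)
  × (½ ≤ℚ ½ *ℚ indicator (answer b) v₀ +ℚ ½ *ℚ indicator (answer b) v₁)
coinFlip-oneDecides {true}  first  = refl , ℚ.≤-refl
coinFlip-oneDecides {true}  second = refl , ℚ.≤-refl
coinFlip-oneDecides {false} first  = refl , ℚ.≤-refl
coinFlip-oneDecides {false} second = refl , ℚ.≤-refl

module Simulation {S : Set} {n : ℕ} (step : S → Bool → S)
  (Valid : S → Set) (step-valid : ∀ s a → Valid s → Valid (step s a))
  (encode : S → Fin n) (decode : Fin n → S) (decode-encode : ∀ s → Valid s → decode (encode s) ≡ s)
  where

  encodedStep : Fin n → Bool → Fin n
  encodedStep i a = encode (step (decode i) a)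

  decode-foldl-encodedStep : ∀ s w → Valid s → decode (foldl encodedStep (encode s) w) ≡ foldl step s w
  decode-foldl-encodedStep s []      valid = decode-encode s valid
  decode-foldl-encodedStep s (a ∷ w) valid =
    trans (cong (λ s′ → decode (foldl encodedStep (encode (step s′ a)) w)) (decode-encode s valid))
          (decode-foldl-encodedStep (step s a) w (step-valid s a valid))

open Inverse 2↔Bool using ()
  renaming (to to finToBool; from to boolToFin; strictlyInverseˡ to finToBool-boolToFin)

bitsToFin : ∀ n → List Bool → Fin (2 ^ n)
bitsToFin zero    _        = zero
bitsToFin (suc n) []       = combine {2} zero (bitsToFin n [])
bitsToFin (suc n) (b ∷ bs) = combine (boolToFin b) (bitsToFin n bs)

finToBits : ∀ n → Fin (2 ^ n) → List Bool
finToBits zero    _ = []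
finToBits (suc n) i = finToBool (quotient {2} (2 ^ n) i) ∷ finToBits n (remainder {2} (2 ^ n) i)

finToBits-bitsToFin : ∀ n bs → length bs ≡ n → finToBits n (bitsToFin n bs) ≡ bs
finToBits-bitsToFin zero    []       _ = refl
finToBits-bitsToFin (suc n) (b ∷ bs) e = cong₂ _∷_
  (trans (cong (finToBool ∘ proj₁) remQuot≡) (finToBool-boolToFin b))
  (trans (cong (finToBits n ∘ proj₂) remQuot≡) (finToBits-bitsToFin n bs (suc-injective e)))
  where remQuot≡ = remQuot-combine {2} {2 ^ n} (boolToFin b) (bitsToFin n bs)

-- The queue automaton

foldl-preserves : ∀ {S : Set} (P : S → Set) (f : S → Bool → S) →
  (∀ s a → P s → P (f s a)) → ∀ s w → P s → P (foldl f s w)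
foldl-preserves P f f-preserves s []      Ps = Ps
foldl-preserves P f f-preserves s (a ∷ w) Ps = foldl-preserves P f f-preserves (f s a) w (f-preserves s a Ps)

QState : Set
QState = Bool × List Bool

rotate : List Bool → Bool → List Bool
rotate []      a = []
rotate (x ∷ r) a = r ++ (x xor a) ∷ []

step : QState → Bool → QState
step (true  , r) a = false , rotate r a
step (false , r) a = true  , r

queueVerdict : QState → Verdict
queueVerdict (true  , b ∷ _) = answer b
queueVerdict (true  , [])    = neutral
queueVerdict (false , _)     = neutral

idle-verdict : ∀ {s} → proj₁ s ≡ false → queueVerdict s ≡ neutral
idle-verdict {false , _} refl = refl

length-rotate : ∀ r a → length (rotate r a) ≡ length r
length-rotate []      a = refl
length-rotate (x ∷ r) a = trans (length-++ r) (+-comm (length r) 1)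

step-length : ∀ s a → length (proj₂ (step s a)) ≡ length (proj₂ s)
step-length (true  , r) a = length-rotate r a
step-length (false , r) a = refl

foldl-step-phase : ∀ w t r r′ → proj₁ (foldl step (not t , r) w) ≡ not (proj₁ (foldl step (t , r′) w))
foldl-step-phase []      t     r r′ = refl
foldl-step-phase (a ∷ w) true  r r′ = foldl-step-phase w false r (rotate r′ a)
foldl-step-phase (a ∷ w) false r r′ = foldl-step-phase w true (rotate r a) r′

flattenPairs : List (Bool × Bool) → List Bool
flattenPairs []             = []
flattenPairs ((a , b) ∷ ps) = a ∷ b ∷ flattenPairs ps

length-flattenPairs : ∀ ps → length (flattenPairs ps) ≡ 2 * length ps
length-flattenPairs []       = refl
length-flattenPairs (_ ∷ ps) =
  trans (cong (λ m → 2 + m) (length-flattenPairs ps)) (sym (*-suc 2 (length ps)))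

flattenPairs-length-≡ : ∀ ps m → length (flattenPairs ps) ≡ 2 * m → length ps ≡ m
flattenPairs-length-≡ ps m e = *-cancelˡ-≡ (length ps) m 2 (trans (sym (length-flattenPairs ps)) e)

flattenPairs-length-< : ∀ ps m → length (flattenPairs ps) < 2 * m → length ps < m
flattenPairs-length-< ps m lt = *-cancelˡ-< 2 (length ps) m (subst (_< 2 * m) (length-flattenPairs ps) lt)

pairUp : ∀ v → (∃ λ ps → v ≡ flattenPairs ps) ⊎ (∃₂ λ a ps → v ≡ a ∷ flattenPairs ps)
pairUp []      = inj₁ ([] , refl)
pairUp (a ∷ v) with pairUp v
... | inj₁ (ps , refl)     = inj₂ (a , ps , refl)
... | inj₂ (b , ps , refl) = inj₁ ((a , b) ∷ ps , refl)

foldl-step-flattenPairs : ∀ xs ys ps → length ps ≡ length xs →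
  foldl step (true , xs ++ ys) (flattenPairs ps) ≡ (true , ys ++ zipWith _xor_ xs (map proj₁ ps))
foldl-step-flattenPairs []       ys []             _ = cong (true ,_) (sym (++-identityʳ ys))
foldl-step-flattenPairs (x ∷ xs) ys ((a , b) ∷ ps) e = begin
    foldl step (true , (xs ++ ys) ++ (x xor a) ∷ []) (flattenPairs ps)
  ≡⟨ cong (λ r → foldl step (true , r) (flattenPairs ps)) (++-assoc xs ys _) ⟩
    foldl step (true , xs ++ ys ++ (x xor a) ∷ []) (flattenPairs ps)
  ≡⟨ foldl-step-flattenPairs xs _ ps (suc-injective e) ⟩
    (true , (ys ++ (x xor a) ∷ []) ++ zipWith _xor_ xs (map proj₁ ps))
  ≡⟨ cong (true ,_) (++-assoc ys _ _) ⟩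
    (true , ys ++ (x xor a) ∷ zipWith _xor_ xs (map proj₁ ps)) ∎
  where open ≡-Reasoning

replicate-+ : ∀ {A : Set} m n (x : A) → replicate (m + n) x ≡ replicate m x ++ replicate n x
replicate-+ zero    n x = refl
replicate-+ (suc m) n x = cong (x ∷_) (replicate-+ m n x)

-- Splitting words into a short prefix and blocks

blockWord : Bool × List Bool → List Bool
blockWord c = proj₁ c ∷ proj₂ c

BlockShaped : ℕ → List (Bool × List Bool) → Set
BlockShaped k bs = ∀ c → c ∈ bs → length (proj₂ c) ≡ 2 * k ∸ 1

xorAll-nonEmpty : ∀ (bs : List (Bool × List Bool)) → xorAll (map proj₁ bs) ≡ true → 0 < length bs
xorAll-nonEmpty (_ ∷ _) _ = s≤s z≤n

record Decomposition (k : ℕ) (w : List Bool) : Set where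
  field
    prefix       : List Bool
    blocks       : List (Bool × List Bool)
    prefix-short : length prefix < 2 * k
    shaped       : BlockShaped k blocks
    splits       : w ≡ prefix ++ concatMap blockWord blocks

decompose : ∀ k → 0 < k → ∀ w → Decomposition k w
decompose (suc k) _ [] = record
  { prefix = [] ; blocks = [] ; prefix-short = s≤s z≤n ; shaped = λ _ () ; splits = refl }
decompose k k>0 (a ∷ w) with decompose k k>0 w
... | record { prefix = w₀ ; blocks = bs ; prefix-short = short ; shaped = shaped ; splits = refl }
    with suc (length w₀) <? 2 * k
...   | yes still-short = record
  { prefix = a ∷ w₀ ; blocks = bs ; prefix-short = still-short ; shaped = shaped ; splits = refl }
...   | no full = record
  { prefix = [] ; blocks = (a , w₀) ∷ bs ; prefix-short = 0<2k ; shaped = shaped′ ; splits = refl }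
  where
  0<2k : 0 < 2 * k
  0<2k = ≤-<-trans z≤n short
  shaped′ : BlockShaped k ((a , w₀) ∷ bs)
  shaped′ _ (here refl) = cong (_∸ 1) (≤-antisym short (≮⇒≥ full))
  shaped′ c (there c∈bs) = shaped c c∈bs

module ModXor (n : ℕ) where

  k : ℕ
  k = suc n

  zeros : List Bool
  zeros = replicate k false

  start₀ start₁ : QState
  start₀ = false , zeros
  start₁ = true  , zeros

  Valid : QState → Set
  Valid s = length (proj₂ s) ≡ k

  step-valid : ∀ s a → Valid s → Valid (step s a)
  step-valid s a valid = trans (step-length s a) valid

  record Ready (b : Bool) (s : QState) : Set where
    constructor ready
    field
      queue        : List Bool
      shape        : s ≡ (true , b ∷ queue)
      queue-length : length queue ≡ n

  ready-verdict : ∀ {b s} → Ready b s → queueVerdict s ≡ answer b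
  ready-verdict (ready _ refl _) = refl

  ready-foldl : ∀ {b r} s w → Valid s → foldl step s w ≡ (true , b ∷ r) → Ready b (foldl step s w)
  ready-foldl s w valid e =
    ready _ e (suc-injective (trans (cong (length ∘ proj₂) (sym e))
                                    (foldl-preserves Valid step step-valid s w valid)))

  other-idle : ∀ {b} w t r r′ → Ready b (foldl step (t , r) w) →
    queueVerdict (foldl step (not t , r′) w) ≡ neutral
  other-idle w t r r′ (ready _ e _) =
    idle-verdict (trans (foldl-step-phase w t r′ r) (cong (not ∘ proj₁) e))

  decided-by₀ : ∀ {b} w → Ready b (foldl step start₀ w) →
    OneDecides b (queueVerdict (foldl step start₀ w)) (queueVerdict (foldl step start₁ w))
  decided-by₀ w s-ready =
    subst₂ (OneDecides _) (sym (ready-verdict s-ready)) (sym (other-idle w false zeros zeros s-ready)) first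

  decided-by₁ : ∀ {b} w → Ready b (foldl step start₁ w) →
    OneDecides b (queueVerdict (foldl step start₀ w)) (queueVerdict (foldl step start₁ w))
  decided-by₁ w s-ready =
    subst₂ (OneDecides _) (sym (other-idle w true zeros zeros s-ready)) (sym (ready-verdict s-ready)) second

  foldl-ready-pairs : ∀ {b s} x y ps → Ready b s → length ps ≡ n →
    Ready (b xor x) (foldl step s (flattenPairs ((x , y) ∷ ps)))
  foldl-ready-pairs {b} x y ps (ready r refl lr) lps =
    ready-foldl (true , b ∷ r) v (cong suc lr)
      (trans (cong (λ q → foldl step (true , q) v) (sym (++-identityʳ (b ∷ r))))
             (foldl-step-flattenPairs (b ∷ r) [] ((x , y) ∷ ps) (cong suc (trans lps (sym lr)))))
    where v = flattenPairs ((x , y) ∷ ps)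

  foldl-block : ∀ {b s} x u → Ready b s → length u ≡ 2 * k ∸ 1 →
    Ready (b xor x) (foldl step s (x ∷ u))
  foldl-block x u s-ready lu with pairUp (x ∷ u)
  ... | inj₁ ((_ , y) ∷ ps , refl) = foldl-ready-pairs x y ps s-ready
    (flattenPairs-length-≡ ps n (suc-injective (suc-injective (trans (cong suc lu) (*-suc 2 n)))))
  ... | inj₂ (_ , ps , refl) =
    ⊥-elim (even≢odd k (length ps) (sym (trans (cong suc (sym (length-flattenPairs ps))) (cong suc lu))))

  foldl-blocks : ∀ {b s} bs → BlockShaped k bs → Ready b s →
    Ready (b xor xorAll (map proj₁ bs)) (foldl step s (concatMap blockWord bs))
  foldl-blocks {b} []       shaped s-ready = subst (λ c → Ready c _) (sym (xor-identityʳ b)) s-ready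
  foldl-blocks {b} {s} ((x , u) ∷ bs) shaped s-ready =
    subst₂ Ready (xor-assoc b x _) (sym (foldl-++ step s (x ∷ u) _))
      (foldl-blocks bs (λ c c∈bs → shaped c (there c∈bs)) (foldl-block x u s-ready (shaped _ (here refl))))

  foldl-prefix : ∀ ps → length ps ≤ n → Ready false (foldl step start₁ (flattenPairs ps))
  foldl-prefix ps q≤n = ready-foldl start₁ (flattenPairs ps) (length-replicate k)
    (trans (cong (λ r → foldl step (true , r) (flattenPairs ps)) zeros-split)
           (foldl-step-flattenPairs (replicate q false) (false ∷ replicate (n ∸ q) false) ps
                                    (sym (length-replicate q))))
    where
    q = length ps
    zeros-split : zeros ≡ replicate q false ++ false ∷ replicate (n ∸ q) false
    zeros-split =
      trans (cong (λ m → replicate m false) (sym (trans (+-suc q (n ∸ q)) (cong suc (m+[n∸m]≡n q≤n)))))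
            (replicate-+ q (suc (n ∸ q)) false)

  prefix-ready : ∀ w₀ → length w₀ < 2 * k →
    Ready false (foldl step start₁ w₀) ⊎ Ready false (foldl step start₀ w₀)
  prefix-ready w₀ short with pairUp w₀
  ... | inj₁ (ps , refl)     =
    inj₁ (foldl-prefix ps (s≤s⁻¹ (flattenPairs-length-< ps k short)))
  ... | inj₂ (_ , ps , refl) =
    inj₂ (foldl-prefix ps (s≤s⁻¹ (flattenPairs-length-< ps k (<-trans (n<1+n _) short))))

  foldl-prefix-blocks : ∀ {s} w₀ bs → BlockShaped k bs → Ready false (foldl step s w₀) →
    Ready (xorAll (map proj₁ bs)) (foldl step s (w₀ ++ concatMap blockWord bs))
  foldl-prefix-blocks {s} w₀ bs shaped s-ready =
    subst (Ready _) (sym (foldl-++ step s w₀ _)) (foldl-blocks bs shaped s-ready)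

  decides : ∀ {w} (d : Decomposition k w) →
    OneDecides (xorAll (map proj₁ (Decomposition.blocks d)))
               (queueVerdict (foldl step start₀ w)) (queueVerdict (foldl step start₁ w))
  decides record { prefix = w₀ ; blocks = bs ; prefix-short = short ; shaped = shaped ; splits = refl }
    with prefix-ready w₀ short
  ... | inj₁ s-ready = decided-by₁ (w₀ ++ concatMap blockWord bs) (foldl-prefix-blocks w₀ bs shaped s-ready)
  ... | inj₂ s-ready = decided-by₀ (w₀ ++ concatMap blockWord bs) (foldl-prefix-blocks w₀ bs shaped s-ready)

  encodeState : QState → Fin (2 * 2 ^ k)
  encodeState (t , r) = bitsToFin (suc k) (t ∷ r)

  decodeState : Fin (2 * 2 ^ k) → QState
  decodeState i = finToBool (quotient {2} (2 ^ k) i) , finToBits k (remainder {2} (2 ^ k) i)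

  decodeState-encodeState : ∀ s → Valid s → decodeState (encodeState s) ≡ s
  decodeState-encodeState (t , r) valid =
    let (t≡ , r≡) = ∷-injective (finToBits-bitsToFin (suc k) (t ∷ r) (cong suc valid)) in cong₂ _,_ t≡ r≡

  open Simulation step Valid step-valid encodeState decodeState decodeState-encodeState

  modxorPFA : LasVegasPFA (2 * 2 ^ k)
  modxorPFA = coinFlipStartPFA encodedStep (queueVerdict ∘ decodeState) (encodeState start₀) (encodeState start₁)

  probVerdict-modxorPFA : ∀ v w → probVerdict modxorPFA v w
    ≡ ½ *ℚ indicator v (queueVerdict (foldl step start₀ w))
      +ℚ ½ *ℚ indicator v (queueVerdict (foldl step start₁ w))
  probVerdict-modxorPFA v w = trans (probVerdict-coinFlipStartPFA encodedStep _ _ _ v w)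
    (cong₂ (λ s₀ s₁ → ½ *ℚ indicator v (queueVerdict s₀) +ℚ ½ *ℚ indicator v (queueVerdict s₁))
           (decode-foldl-encodedStep start₀ w (length-replicate k))
           (decode-foldl-encodedStep start₁ w (length-replicate k)))

  Outcome : Bool → List Bool → Set
  Outcome b w = (probVerdict modxorPFA (answer (not b)) w ≡ 0ℚ) × (½ ≤ℚ probVerdict modxorPFA (answer b) w)

  decomposition-outcome : ∀ {w} (d : Decomposition k w) → Outcome (xorAll (map proj₁ (Decomposition.blocks d))) w
  decomposition-outcome {w} d =
    let (no-error , success) = coinFlip-oneDecides (decides d)
    in trans (probVerdict-modxorPFA (answer (not parity)) w) no-error ,
       subst (½ ≤ℚ_) (sym (probVerdict-modxorPFA (answer parity) w)) success
    where parity = xorAll (map proj₁ (Decomposition.blocks d))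

  modxorPFA-recognizes : RecognizesLV modxorPFA (MODXOR k) ½
  modxorPFA-recognizes w = member , nonMember
    where
    member : MODXOR k w → Outcome true w
    member (w₀ , bs , short , _ , shaped , splits , odd) = subst (λ b → Outcome b w) odd
      (decomposition-outcome (record
        { prefix = w₀ ; blocks = bs ; prefix-short = short ; shaped = shaped ; splits = splits }))
    nonMember : ¬ MODXOR k w → Outcome false w
    nonMember w∉ with decompose k (s≤s z≤n) w
    ... | d with xorAll (map proj₁ (Decomposition.blocks d)) in parity
    ...   | true  = ⊥-elim (w∉ (prefix , blocks , prefix-short , xorAll-nonEmpty blocks parity ,
                              shaped , splits , parity))
      where open Decomposition d
    ...   | false = subst (λ b → Outcome b w) parity (decomposition-outcome d)

theorem10 : (k : ℕ) → 0 < k → Σ (LasVegasPFA (2 * 2 ^ k)) (λ A → RecognizesLV A (MODXOR k) ½)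
theorem10 (suc n) _ = ModXor.modxorPFA n , ModXor.modxorPFA-recognizes n
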